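{- Let $k,d,n$ be positive integers with $d<n$. For every family $\mathcal{A}\subset 2^{[n]}$ with $\mathrm{VC}(\triangle\mathcal{A}^k)\le d$, we have $|\mathcal{A}|\le p(n,k,d)$. Moreover, there are families $\mathcal{A}\subset 2^{[n]}$ with $\mathrm{VC}(\triangle\mathcal{A}^k)\le d$ and $|\mathcal{A}|=p(n,k,d)$. That is, $p'(n,k,d)=p(n,k,d)$.
   Context: $[n]=\{1,\dots,n\}$. For a family $\mathcal{F}\subset 2^{[n]}$, a set $Y\subset[n]$ is shattered by $\mathcal{F}$ if $\{S\cap Y: S\in\mathcal{F}\}=2^Y$; $\mathrm{VC}(\mathcal{F})$ is the largest cardinality of a set shattered by $\mathcal{F}$. $\triangle\mathcal{F}^k=\{S_1\triangle\cdots\triangle S_k: S_i\in\mathcal{F}\}$ and $\cup\mathcal{F}^k=\{S_1\cup\cdots\cup S_k: S_i\in\mathcal{F}\}$. A family $\mathcal{F}\subset 2^{[n]}$ is $k$-wise $(n-d)$-union if every member of $\cup\mathcal{F}^k$ has cardinality at most $d$. $p(n,k,d)$ is the maximum size of a $k$-wise $(n-d)$-union family $\mathcal{F}\subset 2^{[n]}$, and $p'(n,k,d)$ is the maximum size of a family $\mathcal{F}\subset 2^{[n]}$ with $\mathrm{VC}(\triangle\mathcal{F}^k)\le d$. -}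

module Defs where

open import Data.Nat using (ℕ; _≤_)
open import Data.Bool using (_xor_)
open import Data.Fin using (Fin)
open import Data.Fin.Subset using (Subset; ⊥; _∩_; _∪_; _⊆_; ∣_∣)
open import Data.Vec using (zipWith)
open import Data.Vec.Functional using (foldr)
open import Data.List using (List; length)
open import Data.List.Relation.Unary.Unique.Propositional using (Unique)
import Data.List.Membership.Propositional as LM
open import Data.Product using (Σ; ∃; ∃-syntax; _×_)
open import Relation.Binary.PropositionalEquality using (_≡_)

record Family (n : ℕ) : Set where
  constructor family
  field
    members : List (Subset n)
    unique  : Unique members

open Family public

_∈F_ : ∀ {n} → Subset n → Family n → Set
S ∈F F = S LM.∈ members F

size : ∀ {n} → Family n → ℕ
size F = length (members F)

_△_ : ∀ {n} → Subset n → Subset n → Subset n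
_△_ = zipWith _xor_

△ₖ : ∀ {n k} → (Fin k → Subset n) → Subset n
△ₖ S = foldr _△_ ⊥ S

∪ₖ : ∀ {n k} → (Fin k → Subset n) → Subset n
∪ₖ S = foldr _∪_ ⊥ S

InSymDiffPower : ∀ {n} → Family n → ℕ → Subset n → Set
InSymDiffPower {n} F k X =
  ∃[ S ] ((∀ i → S i ∈F F) × (X ≡ △ₖ {n} {k} S))

Shatters : ∀ {n} → (Subset n → Set) → Subset n → Set
Shatters G Y = ∀ Z → Z ⊆ Y → ∃[ S ] (G S × (S ∩ Y ≡ Z))

VC≤ : ∀ {n} → (Subset n → Set) → ℕ → Set
VC≤ G d = ∀ Y → Shatters G Y → ∣ Y ∣ ≤ d

-- F is k-wise (n-d)-union: every member of ∪F^k has cardinality ≤ d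
KWiseUnion : ∀ {n} → ℕ → ℕ → Family n → Set
KWiseUnion {n} k d F =
  (S : Fin k → Subset n) → (∀ i → S i ∈F F) → ∣ ∪ₖ {n} {k} S ∣ ≤ d

VCSymDiffBounded : ∀ {n} → ℕ → ℕ → Family n → Set
VCSymDiffBounded k d F = VC≤ (InSymDiffPower F k) d

IsMaxSize : ∀ {n} → (Family n → Set) → ℕ → Set
IsMaxSize {n} P m = (∃[ F ] (P F × size F ≡ m)) × (∀ (F : Family n) → P F → size F ≤ m)

IsP : ℕ → ℕ → ℕ → ℕ → Set
IsP n k d m = IsMaxSize {n} (KWiseUnion k d) m

IsP' : ℕ → ℕ → ℕ → ℕ → Set
IsP' n k d m = IsMaxSize {n} (VCSymDiffBounded k d) m

module Submission where

-- (1) A k-wise (n-d)-union family F has VC(△F^k) ≤ d: if Y is shattered, then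
--     Y ⊆ S₁ △ ⋯ △ S_k ⊆ S₁ ∪ ⋯ ∪ S_k for some Sₗ ∈ F, and the union has ≤ d points.
-- (2) Every Z ⊆ S₁ ∪ ⋯ ∪ S_k equals T₁ △ ⋯ △ T_k for some Tₗ ⊆ Sₗ.  Hence in a
--     down-closed family every k-fold union is shattered by △F^k, so a down-closed
--     family with VC(△F^k) ≤ d is k-wise (n-d)-union.
-- (3) The down-shift at i (delete i from S unless S - i is already present) keeps
--     the size of a family and the bound VC(△F^k) ≤ d, and it lowers the total
--     weight Σ|S| unless the family is closed under single deletions.  Iterating
--     yields a down-closed family of the same size, so by (2) every family with
--     VC(△F^k) ≤ d is matched in size by a k-wise (n-d)-union family.
-- (4) A decidable hereditary property of families has a maximal attainable size:
--     search all sublists of the list of the 2^n subsets of [n].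
-- Theorem 5 applies (4) to the k-wise (n-d)-union property and transfers the
-- maximum along (1) and (3).

open import Defs
open import Data.Nat using (ℕ; zero; suc; _≤_; _<_; s≤s; z≤n; _≤?_)
open import Data.Nat.Properties using (≤-refl; ≤-trans; n≤1+n; +-mono-≤; +-mono-<-≤; +-mono-≤-<)
open import Data.Nat.Induction using (<-wellFounded)
open import Data.Nat.ListAction using (sum)
open import Data.Bool using (Bool; true; false; _xor_; _∧_; not)
import Data.Bool.Properties as Bool
open import Data.Fin using (Fin; zero; suc)
open import Data.Fin.Properties using (suc-injective; any?) renaming (_≟_ to _≟ᶠ_)
open import Data.Fin.Subset using (Subset; ⊥; _∩_; _∪_; ∁; _⊆_; _∈_; ∣_∣)
open import Data.Fin.Subset.Properties
  using ( ⊆-antisym; ⊆-trans; ⊥⊆; p∩q⊆p; p∩q⊆q; x∈p∩q⁺; x∈p∩q⁻; p⊆p∪q; q⊆p∪q; x∈p∪q⁻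
        ; x∈∁p⇒x∉p; p⊆q⇒∣p∣≤∣q∣ )
open import Data.Vec using ([]; _∷_; lookup; _[_]≔_)
open import Data.Vec.Properties
  using ( lookup-zipWith; lookup-replicate; lookup-map; tabulate∘lookup; tabulate-cong
        ; []=⇒lookup; lookup⇒[]=; lookup∘update; lookup∘update′
        ; []≔-lookup; []≔-idempotent; []≔-updates; ∷-injective; ≡-dec )
open import Data.Vec.Functional as Vector using (Vector; foldr; tail; updateAt)
open import Data.Vec.Functional.Properties using (updateAt-updates; updateAt-minimal)
open import Data.List using (List; []; _∷_; map; length; filter; _++_; cartesianProductWith)
open import Data.List.Properties using (length-map; map-∘)
open import Data.List.Membership.Propositional using (find; lose) renaming (_∈_ to _∈ₗ_; _∉_ to _∉ₗ_)
open import Data.List.Membership.Propositional.Properties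
  using (∈-map⁺; ∈-map⁻; ∈-++⁺ˡ; ∈-++⁺ʳ; ∈-filter⁺; ∈-filter⁻; ∈-cartesianProductWith⁺)
import Data.List.Membership.DecPropositional as DecMembership
open import Data.List.Membership.Propositional.Properties.WithK using (unique∧set⇒bag)
open import Data.List.Relation.Binary.BagAndSetEquality using (∼bag⇒↭)
open import Data.List.Relation.Binary.Permutation.Propositional.Properties using (↭-length)
open import Data.List.Relation.Unary.Any as Any using (Any; here; there)
import Data.List.Relation.Unary.All as All
import Data.List.Relation.Unary.All.Properties as AllProperties
open import Data.List.Relation.Unary.AllPairs using ([]; _∷_)
open import Data.List.Relation.Unary.Unique.Propositional using (Unique)
import Data.List.Relation.Unary.Unique.Propositional.Properties as Unique
import Data.List.Relation.Unary.Unique.DecPropositional as DecUnique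
open import Data.List.Extrema.Nat using (argmax; argmax-all; f[xs]≤f[argmax])
open import Data.Product using (∃-syntax; _×_; _,_; proj₁; proj₂)
open import Data.Sum using ([_,_]′)
open import Function using (_∘_; id; const)
open import Function.Bundles using (mk⇔)
open import Induction.WellFounded using (Acc; acc)
open import Relation.Nullary using (Dec; yes; no; ¬_; contradiction)
import Relation.Nullary.Decidable as Dec
open import Relation.Nullary.Decidable using (_×-dec_; ¬?)
open import Relation.Binary.PropositionalEquality

variable
  n k : ℕ

lookup-ext : {X Y : Subset n} → (∀ c → lookup X c ≡ lookup Y c) → X ≡ Y
lookup-ext {X = X} {Y} X≗Y =
  trans (sym (tabulate∘lookup X)) (trans (tabulate-cong X≗Y) (tabulate∘lookup Y))

lookup-∩ : (X Y : Subset n) (c : Fin n) → lookup (X ∩ Y) c ≡ lookup X c ∧ lookup Y c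
lookup-∩ X Y c = lookup-zipWith _∧_ c X Y

lookup-△ : (X Y : Subset n) (c : Fin n) → lookup (X △ Y) c ≡ lookup X c xor lookup Y c
lookup-△ X Y c = lookup-zipWith _xor_ c X Y

lookup-∁ : (X : Subset n) (c : Fin n) → lookup (∁ X) c ≡ not (lookup X c)
lookup-∁ X c = lookup-map c not X

parity : Vector Bool k → Bool
parity = foldr _xor_ false

lookup-△ₖ : (S : Fin k → Subset n) (c : Fin n) → lookup (△ₖ S) c ≡ parity (λ l → lookup (S l) c)
lookup-△ₖ {k = zero}  S c = lookup-replicate c false
lookup-△ₖ {k = suc k} S c =
  trans (lookup-△ (S zero) (△ₖ (tail S)) c) (cong (lookup (S zero) c xor_) (lookup-△ₖ (tail S) c))

parity-cong : {f g : Vector Bool k} → (∀ l → f l ≡ g l) → parity f ≡ parity g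
parity-cong {k = zero}  f≗g = refl
parity-cong {k = suc k} f≗g = cong₂ _xor_ (f≗g zero) (parity-cong (f≗g ∘ suc))

parity-true⇒∃ : (f : Vector Bool k) → parity f ≡ true → ∃[ j ] f j ≡ true
parity-true⇒∃ {k = suc k} f odd with f zero in f₀
... | true  = zero , f₀
... | false = let j , fj = parity-true⇒∃ (tail f) odd in suc j , fj

xor-cancelˡ : ∀ a b → a xor (a xor b) ≡ b
xor-cancelˡ a b = trans (sym (Bool.xor-assoc a a b)) (cong (_xor b) (Bool.xor-same a))

xor-cancelʳ : ∀ a b → (a xor b) xor b ≡ a
xor-cancelʳ a b =
  trans (Bool.xor-assoc a b b) (trans (cong (a xor_) (Bool.xor-same b)) (Bool.xor-identityʳ a))

xor-swap : ∀ a b c → a xor (b xor c) ≡ b xor (a xor c)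
xor-swap a b c =
  trans (sym (Bool.xor-assoc a b c)) (trans (cong (_xor c) (Bool.xor-comm a b)) (Bool.xor-assoc b a c))

parity-update : (f g : Vector Bool k) (j : Fin k) → (∀ l → l ≢ j → f l ≡ g l) →
  parity g ≡ g j xor (f j xor parity f)
parity-update {k = suc k} f g zero f≈g = cong (g zero xor_) (begin
  parity (tail g)                          ≡⟨ parity-cong (λ l → sym (f≈g (suc l) λ ())) ⟩
  parity (tail f)                          ≡⟨ sym (xor-cancelˡ (f zero) _) ⟩
  f zero xor (f zero xor parity (tail f))  ∎)
  where open ≡-Reasoning
parity-update {k = suc k} f g (suc j) f≈g = begin
  g zero xor parity (tail g)
    ≡⟨ cong₂ _xor_ (sym (f≈g zero λ ())) (parity-update (tail f) (tail g) j tail-agrees) ⟩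
  f zero xor (g (suc j) xor (f (suc j) xor parity (tail f)))
    ≡⟨ xor-swap (f zero) (g (suc j)) _ ⟩
  g (suc j) xor (f zero xor (f (suc j) xor parity (tail f)))
    ≡⟨ cong (g (suc j) xor_) (xor-swap (f zero) (f (suc j)) _) ⟩
  g (suc j) xor (f (suc j) xor (f zero xor parity (tail f)))  ∎
  where
  open ≡-Reasoning
  tail-agrees : ∀ l → l ≢ j → tail f l ≡ tail g l
  tail-agrees l l≢j = f≈g (suc l) (l≢j ∘ suc-injective)

-- (1) k-wise (n-d)-union families have VC(△F^k) ≤ d.

∈-∪ₖ : (S : Fin k → Subset n) (j : Fin k) {x : Fin n} → x ∈ S j → x ∈ ∪ₖ S
∈-∪ₖ {k = suc k} S zero    x∈Sj = p⊆p∪q (∪ₖ (tail S)) x∈Sj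
∈-∪ₖ {k = suc k} S (suc j) x∈Sj = q⊆p∪q (S zero) _ (∈-∪ₖ (tail S) j x∈Sj)

-- A point of S₁ △ ⋯ △ S_k lies in an odd number, hence at least one, of the Sₗ.
△ₖ⊆∪ₖ : (S : Fin k → Subset n) → △ₖ S ⊆ ∪ₖ S
△ₖ⊆∪ₖ S {x} x∈△ =
  let j , x∈Sj = parity-true⇒∃ (λ l → lookup (S l) x) (trans (sym (lookup-△ₖ S x)) ([]=⇒lookup x∈△))
  in ∈-∪ₖ S j (lookup⇒[]= x (S j) x∈Sj)

-- A shattered Y is the trace of some S₁ △ ⋯ △ S_k, so Y ⊆ S₁ ∪ ⋯ ∪ S_k.
kwiseUnion⇒vcBounded : (k d : ℕ) (F : Family n) → KWiseUnion k d F → VCSymDiffBounded k d F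
kwiseUnion⇒vcBounded k d F kw Y shattered with shattered Y id
... | _ , (S , S∈F , refl) , △S∩Y≡Y = ≤-trans (p⊆q⇒∣p∣≤∣q∣ Y⊆∪S) (kw S S∈F)
  where
  Y⊆∪S : Y ⊆ ∪ₖ S
  Y⊆∪S = ⊆-trans (subst (_⊆ △ₖ S) △S∩Y≡Y (p∩q⊆p (△ₖ S) Y)) (△ₖ⊆∪ₖ S)

-- (2) Down-closed families with VC(△F^k) ≤ d are k-wise (n-d)-union.

∩-△-∩∁ : (Z S : Subset n) → (Z ∩ S) △ (Z ∩ ∁ S) ≡ Z
∩-△-∩∁ Z S = lookup-ext pointwise
  where
  pointwise : ∀ c → lookup ((Z ∩ S) △ (Z ∩ ∁ S)) c ≡ lookup Z c
  pointwise c = begin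
    lookup ((Z ∩ S) △ (Z ∩ ∁ S)) c
      ≡⟨ lookup-△ (Z ∩ S) (Z ∩ ∁ S) c ⟩
    lookup (Z ∩ S) c xor lookup (Z ∩ ∁ S) c
      ≡⟨ cong₂ _xor_ (lookup-∩ Z S c) (trans (lookup-∩ Z (∁ S) c) (cong (lookup Z c ∧_) (lookup-∁ S c))) ⟩
    (lookup Z c ∧ lookup S c) xor (lookup Z c ∧ not (lookup S c))
      ≡⟨ sym (Bool.∧-distribˡ-xor (lookup Z c) (lookup S c) _) ⟩
    lookup Z c ∧ (lookup S c xor not (lookup S c))
      ≡⟨ cong (lookup Z c ∧_) (Bool.xor-inverseʳ (lookup S c)) ⟩
    lookup Z c ∧ true
      ≡⟨ Bool.∧-identityʳ (lookup Z c) ⟩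
    lookup Z c ∎
    where open ≡-Reasoning

-- Every Z ⊆ S₁ ∪ ⋯ ∪ S_k is T₁ △ ⋯ △ T_k with Tₗ ⊆ Sₗ: take T₁ = Z ∩ S₁ and
-- decompose the remainder Z ∩ ∁ S₁ ⊆ S₂ ∪ ⋯ ∪ S_k.
decompose : (S : Fin k → Subset n) (Z : Subset n) → Z ⊆ ∪ₖ S →
  ∃[ T ] ((∀ l → T l ⊆ S l) × △ₖ T ≡ Z)
decompose {k = zero}  S Z Z⊆⊥ = (λ ()) , (λ ()) , ⊆-antisym ⊥⊆ Z⊆⊥
decompose {k = suc k} S Z Z⊆∪S =
  let T , T⊆S , △T≡rest = decompose (tail S) (Z ∩ ∁ (S zero)) rest⊆
  in (Z ∩ S zero) Vector.∷ T ,
     (λ { zero → p∩q⊆q Z (S zero) ; (suc l) → T⊆S l }) ,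
     trans (cong ((Z ∩ S zero) △_) △T≡rest) (∩-△-∩∁ Z (S zero))
  where
  rest⊆ : Z ∩ ∁ (S zero) ⊆ ∪ₖ (tail S)
  rest⊆ x∈rest =
    let x∈Z , x∈∁S₀ = x∈p∩q⁻ Z (∁ (S zero)) x∈rest
    in [ (λ x∈S₀ → contradiction x∈S₀ (x∈∁p⇒x∉p x∈∁S₀)) , id ]′ (x∈p∪q⁻ (S zero) _ (Z⊆∪S x∈Z))

DownClosed : Family n → Set
DownClosed F = ∀ {S T} → S ∈F F → T ⊆ S → T ∈F F

-- In a down-closed family every union S₁ ∪ ⋯ ∪ S_k is shattered by △F^k.
downClosed⇒kwiseUnion : (k d : ℕ) (F : Family n) → DownClosed F → VCSymDiffBounded k d F →
  KWiseUnion k d F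
downClosed⇒kwiseUnion k d F down vc S S∈F = vc (∪ₖ S) union-shattered
  where
  union-shattered : Shatters (InSymDiffPower F k) (∪ₖ S)
  union-shattered Z Z⊆∪S =
    let T , T⊆S , △T≡Z = decompose S Z Z⊆∪S
    in △ₖ T , (T , (λ l → down (S∈F l) (T⊆S l)) , refl) ,
       trans (cong (_∩ ∪ₖ S) △T≡Z) (⊆-antisym (p∩q⊆p Z _) (λ x∈Z → x∈p∩q⁺ (x∈Z , Z⊆∪S x∈Z)))

-- (3) Down-shifts preserve size and VC(△F^k) ≤ d and lead to down-closed families.

record _≈[_]_ (X : Subset n) (i : Fin n) (Y : Subset n) : Set where
  constructor agree-off
  field agree : ∀ c → c ≢ i → lookup X c ≡ lookup Y c

open _≈[_]_

≈-sym : {X Y : Subset n} {i : Fin n} → X ≈[ i ] Y → Y ≈[ i ] X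
≈-sym X≈Y = agree-off λ c c≢i → sym (agree X≈Y c c≢i)

≈-trans : {X Y Z : Subset n} {i : Fin n} → X ≈[ i ] Y → Y ≈[ i ] Z → X ≈[ i ] Z
≈-trans X≈Y Y≈Z = agree-off λ c c≢i → trans (agree X≈Y c c≢i) (agree Y≈Z c c≢i)

≡⇒≈ : {X Y : Subset n} {i : Fin n} → X ≡ Y → X ≈[ i ] Y
≡⇒≈ refl = agree-off λ _ _ → refl

≈-ext : {X Y : Subset n} {i : Fin n} → X ≈[ i ] Y → lookup X i ≡ lookup Y i → X ≡ Y
≈-ext {X = X} {Y} {i} X≈Y Xi≡Yi = lookup-ext pointwise
  where
  pointwise : ∀ c → lookup X c ≡ lookup Y c
  pointwise c with c ≟ᶠ i
  ... | yes refl = Xi≡Yi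
  ... | no c≢i   = agree X≈Y c c≢i

update-≈ : (X : Subset n) (i : Fin n) (b : Bool) → (X [ i ]≔ b) ≈[ i ] X
update-≈ X i b = agree-off λ c c≢i → lookup∘update′ c≢i X b

≈-update : {X Y : Subset n} {i : Fin n} (b : Bool) → X ≈[ i ] Y → X [ i ]≔ b ≡ Y [ i ]≔ b
≈-update {X = X} {Y} {i} b X≈Y =
  ≈-ext (≈-trans (update-≈ X i b) (≈-trans X≈Y (≈-sym (update-≈ Y i b))))
        (trans (lookup∘update i X b) (sym (lookup∘update i Y b)))

∩-≈ : {X X′ : Subset n} {i : Fin n} (Y : Subset n) → X ≈[ i ] X′ → (X ∩ Y) ≈[ i ] (X′ ∩ Y)
∩-≈ {X = X} {X′} Y X≈X′ = agree-off λ c c≢i →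
  trans (lookup-∩ X Y c) (trans (cong (_∧ lookup Y c) (agree X≈X′ c c≢i)) (sym (lookup-∩ X′ Y c)))

△ₖ-≈ : {S T : Fin k → Subset n} {i : Fin n} → (∀ l → S l ≈[ i ] T l) → △ₖ S ≈[ i ] △ₖ T
△ₖ-≈ {S = S} {T} S≈T = agree-off λ c c≢i →
  trans (lookup-△ₖ S c) (trans (parity-cong λ l → agree (S≈T l) c c≢i) (sym (lookup-△ₖ T c)))

∣delete∣< : (S : Subset n) (i : Fin n) → lookup S i ≡ true → ∣ S [ i ]≔ false ∣ < ∣ S ∣
∣delete∣< (true  ∷ S) zero    _  = ≤-refl
∣delete∣< (true  ∷ S) (suc i) Si = s≤s (∣delete∣< S i Si)
∣delete∣< (false ∷ S) zero    ()
∣delete∣< (false ∷ S) (suc i) Si = ∣delete∣< S i Si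

reinsert : (S : Subset n) {i : Fin n} → lookup S i ≡ true → (S [ i ]≔ false) [ i ]≔ true ≡ S
reinsert S {i} Si = begin
  (S [ i ]≔ false) [ i ]≔ true  ≡⟨ []≔-idempotent S i ⟩
  S [ i ]≔ true                 ≡⟨ cong (S [ i ]≔_) (sym Si) ⟩
  S [ i ]≔ lookup S i           ≡⟨ []≔-lookup S i ⟩
  S                             ∎
  where open ≡-Reasoning

_≟ˢ_ : (X Y : Subset n) → Dec (X ≡ Y)
_≟ˢ_ = ≡-dec Bool._≟_

_∈ₗ?_ : (X : Subset n) (A : List (Subset n)) → Dec (X ∈ₗ A)
_∈ₗ?_ = DecMembership._∈?_ _≟ˢ_

shift : List (Subset n) → Fin n → Subset n → Subset n
shift A i S with lookup S i | (S [ i ]≔ false) ∈ₗ? A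
... | true | no _ = S [ i ]≔ false
... | _    | _    = S

data ShiftView (A : List (Subset n)) (i : Fin n) (S : Subset n) : Subset n → Set where
  kept  : (lookup S i ≡ true → S [ i ]≔ false ∈ₗ A) → ShiftView A i S S
  moved : lookup S i ≡ true → S [ i ]≔ false ∉ₗ A → ShiftView A i S (S [ i ]≔ false)

shift-view : (A : List (Subset n)) (i : Fin n) (S : Subset n) → ShiftView A i S (shift A i S)
shift-view A i S with lookup S i in Si | (S [ i ]≔ false) ∈ₗ? A
... | true  | no S-i∉A  = moved Si S-i∉A
... | true  | yes S-i∈A = kept (const S-i∈A)
... | false | _         = kept (λ Si≡true → contradiction (trans (sym Si) Si≡true) λ ())

shift-≈ : (A : List (Subset n)) (i : Fin n) (S : Subset n) → shift A i S ≈[ i ] S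
shift-≈ A i S with shift A i S | shift-view A i S
... | _ | kept _    = ≡⇒≈ refl
... | _ | moved _ _ = update-≈ S i false

shift-injective : (A : List (Subset n)) (i : Fin n) {S S′ : Subset n} → S ∈ₗ A → S′ ∈ₗ A →
  shift A i S ≡ shift A i S′ → S ≡ S′
shift-injective A i {S} {S′} S∈A S′∈A eq
  with shift A i S | shift-view A i S | shift A i S′ | shift-view A i S′
... | _ | kept _         | _ | kept _          = eq
... | _ | kept _         | _ | moved _ S′-i∉A = contradiction (subst (_∈ₗ A) eq S∈A) S′-i∉A
... | _ | moved _ S-i∉A | _ | kept _          = contradiction (subst (_∈ₗ A) (sym eq) S′∈A) S-i∉A
... | _ | moved Si _     | _ | moved S′i _    =
  trans (sym (reinsert S Si)) (trans (cong (_[ i ]≔ true) eq) (reinsert S′ S′i))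

shift-∣∣≤ : (A : List (Subset n)) (i : Fin n) (S : Subset n) → ∣ shift A i S ∣ ≤ ∣ S ∣
shift-∣∣≤ A i S with shift A i S | shift-view A i S
... | _ | kept _     = ≤-refl
... | _ | moved Si _ = ≤-trans (n≤1+n _) (∣delete∣< S i Si)

shift-∣∣< : (A : List (Subset n)) (i : Fin n) (S : Subset n) →
  lookup S i ≡ true → S [ i ]≔ false ∉ₗ A → ∣ shift A i S ∣ < ∣ S ∣
shift-∣∣< A i S Si S-i∉A with shift A i S | shift-view A i S
... | _ | kept S-i∈A = contradiction (S-i∈A Si) S-i∉A
... | _ | moved _ _  = ∣delete∣< S i Si

-- A shifted set still containing i was not moved, and both it and its i-deletion
-- belong to A, so its i-th coordinate can be set freely inside A.
shift-top : (A : List (Subset n)) (i : Fin n) (S : Subset n) → S ∈ₗ A →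
  lookup (shift A i S) i ≡ true → ∀ b → shift A i S [ i ]≔ b ∈ₗ A
shift-top A i S S∈A top with shift A i S | shift-view A i S
... | _ | moved _ _  = contradiction (trans (sym (lookup∘update i S false)) top) λ ()
... | _ | kept S-i∈A = free
  where
  free : ∀ b → S [ i ]≔ b ∈ₗ A
  free true  = subst (_∈ₗ A) (sym (trans (cong (S [ i ]≔_) (sym top)) ([]≔-lookup S i))) S∈A
  free false = S-i∈A top

map-unique : {A B : Set} (f : A → B) {xs : List A} →
  (∀ {x y} → x ∈ₗ xs → y ∈ₗ xs → f x ≡ f y → x ≡ y) → Unique xs → Unique (map f xs)
map-unique f inj []             = []
map-unique f inj (x∉xs ∷ xs!) =
  AllProperties.map⁺ (All.tabulate λ y∈xs fx≡fy →
    All.lookup x∉xs y∈xs (inj (here refl) (there y∈xs) fx≡fy))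
  ∷ map-unique f (λ x∈ y∈ → inj (there x∈) (there y∈)) xs!

shiftFamily : Family n → Fin n → Family n
shiftFamily F i = family (map (shift (members F) i) (members F))
  (map-unique (shift (members F) i) (shift-injective (members F) i) (unique F))

lift-tuple : (F : Family n) (i : Fin n) (T : Fin k → Subset n) → (∀ l → T l ∈F shiftFamily F i) →
  ∃[ S ] ((∀ l → S l ∈F F) × (∀ l → S l ≈[ i ] T l))
lift-tuple F i T T∈ = (λ l → proj₁ (preimage l)) , (λ l → proj₁ (proj₂ (preimage l))) , S≈T
  where
  preimage : ∀ l → ∃[ S ] (S ∈F F × T l ≡ shift (members F) i S)
  preimage l = ∈-map⁻ (shift (members F) i) (T∈ l)
  S≈T : ∀ l → proj₁ (preimage l) ≈[ i ] T l
  S≈T l = ≈-sym (≈-trans (≡⇒≈ (proj₂ (proj₂ (preimage l)))) (shift-≈ (members F) i _))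

top-free : (F : Family n) (i : Fin n) {T : Subset n} → T ∈F shiftFamily F i →
  lookup T i ≡ true → ∀ b → (T [ i ]≔ b) ∈F F
top-free F i T∈ Ti with ∈-map⁻ (shift (members F) i) T∈
... | S , S∈F , refl = shift-top (members F) i S S∈F Ti

set-parity-bit : (F : Family n) (i : Fin n) (S : Fin k → Subset n) → (∀ l → S l ∈F F) →
  (j : Fin k) → (∀ b → (S j [ i ]≔ b) ∈F F) → (z : Bool) →
  ∃[ S′ ] ((∀ l → S′ l ∈F F) × (∀ l → S′ l ≈[ i ] S l) × lookup (△ₖ S′) i ≡ z)
set-parity-bit F i S S∈F j free z = S′ , S′∈F , S′≈S , bit
  where
  f : Vector Bool _
  f l = lookup (S l) i
  b : Bool
  b = z xor (f j xor parity f)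
  S′ : Fin _ → Subset _
  S′ = updateAt S j (_[ i ]≔ b)
  S′∈F : ∀ l → S′ l ∈F F
  S′∈F l with l ≟ᶠ j
  ... | yes refl = subst (_∈F F) (sym (updateAt-updates j S)) (free b)
  ... | no l≢j   = subst (_∈F F) (sym (updateAt-minimal l j S l≢j)) (S∈F l)
  S′≈S : ∀ l → S′ l ≈[ i ] S l
  S′≈S l with l ≟ᶠ j
  ... | yes refl = ≈-trans (≡⇒≈ (updateAt-updates j S)) (update-≈ (S j) i b)
  ... | no l≢j   = ≡⇒≈ (updateAt-minimal l j S l≢j)
  bit : lookup (△ₖ S′) i ≡ z
  bit = begin
    lookup (△ₖ S′) i
      ≡⟨ lookup-△ₖ S′ i ⟩
    parity (λ l → lookup (S′ l) i)
      ≡⟨ parity-update f _ j (λ l l≢j → cong (λ W → lookup W i) (sym (updateAt-minimal l j S l≢j))) ⟩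
    lookup (S′ j) i xor (f j xor parity f)
      ≡⟨ cong (_xor (f j xor parity f)) S′j-at-i ⟩
    b xor (f j xor parity f)
      ≡⟨ xor-cancelʳ z _ ⟩
    z ∎
    where
    open ≡-Reasoning
    S′j-at-i : lookup (S′ j) i ≡ b
    S′j-at-i = trans (cong (λ W → lookup W i) (updateAt-updates j S)) (lookup∘update i (S j) b)

-- Lifting a tuple from Dᵢ F to F changes the symmetric difference only at i, so the
-- trace on Y is right as soon as it is right at i.
trace-of-lift : {S T : Fin k → Subset n} {i : Fin n} {Y Z : Subset n} → (∀ l → S l ≈[ i ] T l) →
  (△ₖ T ∩ Y) ≈[ i ] Z → lookup (△ₖ S ∩ Y) i ≡ lookup Z i → △ₖ S ∩ Y ≡ Z
trace-of-lift {Y = Y} S≈T △T∩Y≈Z = ≈-ext (≈-trans (∩-≈ Y (△ₖ-≈ S≈T)) △T∩Y≈Z)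

-- If i ∉ Y, traces on Y do not see coordinate i at all.
unshift-outside : (F : Family n) (i : Fin n) {Y : Subset n} → lookup Y i ≡ false →
  Shatters (InSymDiffPower (shiftFamily F i) k) Y → Shatters (InSymDiffPower F k) Y
unshift-outside F i {Y} Yi shattered Z Z⊆Y with shattered Z Z⊆Y
... | _ , (T , T∈ , refl) , △T∩Y≡Z with lift-tuple F i T T∈
... | S , S∈F , S≈T = △ₖ S , (S , S∈F , refl) , trace-of-lift S≈T (≡⇒≈ △T∩Y≡Z) bit
  where
  outside : ∀ X → lookup (X ∩ Y) i ≡ false
  outside X = trans (lookup-∩ X Y i) (trans (cong (lookup X i ∧_) Yi) (Bool.∧-zeroʳ _))
  bit : lookup (△ₖ S ∩ Y) i ≡ lookup Z i
  bit = trans (outside (△ₖ S)) (trans (sym (outside (△ₖ T))) (cong (λ W → lookup W i) △T∩Y≡Z))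

insert-⊆ : {Z Y : Subset n} {i : Fin n} → Z ⊆ Y → lookup Y i ≡ true → Z [ i ]≔ true ⊆ Y
insert-⊆ {Z = Z} {Y} {i} Z⊆Y Yi {x} x∈Z⁺ with x ≟ᶠ i
... | yes refl = lookup⇒[]= i Y Yi
... | no x≢i   = Z⊆Y (lookup⇒[]= x Z (trans (sym (lookup∘update′ x≢i Z true)) ([]=⇒lookup x∈Z⁺)))

∈-of-trace : {X Y Z : Subset n} {i : Fin n} → X ∩ Y ≡ Z → i ∈ Z → lookup X i ≡ true
∈-of-trace {X = X} {Y} X∩Y≡Z i∈Z = []=⇒lookup (proj₁ (x∈p∩q⁻ X Y (subst (_ ∈_) (sym X∩Y≡Z) i∈Z)))

-- If i ∈ Y, realise Z ∪ {i} in Dᵢ F.  Some member Tⱼ of the tuple contains i, so it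
-- may be changed freely at i inside F; use this to give the lifted tuple the bit Z(i).
unshift-inside : (F : Family n) (i : Fin n) {Y : Subset n} → lookup Y i ≡ true →
  Shatters (InSymDiffPower (shiftFamily F i) k) Y → Shatters (InSymDiffPower F k) Y
unshift-inside F i {Y} Yi shattered Z Z⊆Y with shattered (Z [ i ]≔ true) (insert-⊆ Z⊆Y Yi)
... | _ , (T , T∈ , refl) , △T∩Y≡Z⁺
  with parity-true⇒∃ (λ l → lookup (T l) i)
         (trans (sym (lookup-△ₖ T i)) (∈-of-trace △T∩Y≡Z⁺ ([]≔-updates Z i)))
... | j , Tj with lift-tuple F i T T∈
... | S , S∈F , S≈T
  with set-parity-bit F i S S∈F j
         (λ b → subst (_∈F F) (sym (≈-update b (S≈T j))) (top-free F i (T∈ j) Tj b)) (lookup Z i)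
... | S′ , S′∈F , S′≈S , S′-bit =
  △ₖ S′ , (S′ , S′∈F , refl) ,
  trace-of-lift (λ l → ≈-trans (S′≈S l) (S≈T l)) (≈-trans (≡⇒≈ △T∩Y≡Z⁺) (update-≈ Z i true))
    (trans (lookup-∩ (△ₖ S′) Y i) (trans (cong₂ _∧_ S′-bit Yi) (Bool.∧-identityʳ _)))

shift-preserves-vc : (k d : ℕ) (F : Family n) (i : Fin n) →
  VCSymDiffBounded k d F → VCSymDiffBounded k d (shiftFamily F i)
shift-preserves-vc k d F i vc Y shattered with lookup Y i in Yi
... | false = vc Y (unshift-outside F i Yi shattered)
... | true  = vc Y (unshift-inside F i Yi shattered)

weight : Family n → ℕ
weight F = sum (map ∣_∣ (members F))

sum-map-≤ : {A : Set} (f g : A → ℕ) (xs : List A) → (∀ x → f x ≤ g x) →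
  sum (map f xs) ≤ sum (map g xs)
sum-map-≤ f g []       f≤g = z≤n
sum-map-≤ f g (x ∷ xs) f≤g = +-mono-≤ (f≤g x) (sum-map-≤ f g xs f≤g)

sum-map-< : {A : Set} (f g : A → ℕ) {xs : List A} {x₀ : A} → (∀ x → f x ≤ g x) →
  x₀ ∈ₗ xs → f x₀ < g x₀ → sum (map f xs) < sum (map g xs)
sum-map-< f g {x ∷ xs} f≤g (here refl) f<g = +-mono-<-≤ f<g (sum-map-≤ f g xs f≤g)
sum-map-< f g {x ∷ xs} f≤g (there x₀∈) f<g = +-mono-≤-< (f≤g x) (sum-map-< f g f≤g x₀∈ f<g)

DeletionClosed : Family n → Set
DeletionClosed F = ∀ {S} → S ∈F F → ∀ i → lookup S i ≡ true → (S [ i ]≔ false) ∈F F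

Violation : Family n → Set
Violation F = Any (λ S → ∃[ i ] (lookup S i ≡ true × S [ i ]≔ false ∉ₗ members F)) (members F)

violation? : (F : Family n) → Dec (Violation F)
violation? F = Any.any? (λ S → any? λ i →
  (lookup S i Bool.≟ true) ×-dec ¬? ((S [ i ]≔ false) ∈ₗ? members F)) (members F)

no-violation⇒closed : (F : Family n) → ¬ Violation F → DeletionClosed F
no-violation⇒closed F none {S} S∈F i Si with (S [ i ]≔ false) ∈ₗ? members F
... | yes S-i∈F = S-i∈F
... | no S-i∉F  = contradiction (lose S∈F (i , Si , S-i∉F)) none

violation⇒lighter : (F : Family n) → Violation F → ∃[ i ] weight (shiftFamily F i) < weight F
violation⇒lighter F v with find v
... | S , S∈F , i , Si , S-i∉F = i , subst (_< weight F) (cong sum (map-∘ (members F)))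
  (sum-map-< (∣_∣ ∘ shift (members F) i) ∣_∣ (shift-∣∣≤ (members F) i) S∈F
    (shift-∣∣< (members F) i S Si S-i∉F))

deletion-closed-shift : (P : Family n → Set) → (∀ F i → P F → P (shiftFamily F i)) →
  (F : Family n) → Acc _<_ (weight F) → P F →
  ∃[ G ] (P G × DeletionClosed G × size G ≡ size F)
deletion-closed-shift P shift-P F (acc lighter⇒acc) PF with violation? F
... | no none = F , PF , no-violation⇒closed F none , refl
... | yes v with violation⇒lighter F v
... | i , lighter
  with deletion-closed-shift P shift-P (shiftFamily F i) (lighter⇒acc lighter) (shift-P F i PF)
... | G , PG , closed , size≡ = G , PG , closed , trans size≡ (length-map _ (members F))

-- Deleting the points of S ∖ T one at a time stays inside a deletion-closed family.
deletionClosed⇒downClosed : (F : Family n) → DeletionClosed F → DownClosed F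
deletionClosed⇒downClosed F closed {S} = descend S (<-wellFounded ∣ S ∣)
  where
  descend : ∀ S → Acc _<_ ∣ S ∣ → ∀ {T} → S ∈F F → T ⊆ S → T ∈F F
  descend S (acc smaller) {T} S∈F T⊆S
    with any? (λ c → (lookup S c Bool.≟ true) ×-dec (lookup T c Bool.≟ false))
  ... | yes (c , Sc , Tc) =
    descend (S [ c ]≔ false) (smaller (∣delete∣< S c Sc)) (closed S∈F c Sc) T⊆S-c
    where
    T⊆S-c : T ⊆ S [ c ]≔ false
    T⊆S-c {x} x∈T with x ≟ᶠ c
    ... | yes refl = contradiction (trans (sym ([]=⇒lookup x∈T)) Tc) λ ()
    ... | no x≢c   = lookup⇒[]= x _ (trans (lookup∘update′ x≢c S false) ([]=⇒lookup (T⊆S x∈T)))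
  ... | no none = subst (_∈F F) (⊆-antisym S⊆T T⊆S) S∈F
    where
    S⊆T : S ⊆ T
    S⊆T {x} x∈S with lookup T x in Tx
    ... | true  = lookup⇒[]= x T Tx
    ... | false = contradiction (x , []=⇒lookup x∈S , Tx) none

vcBounded⇒kwiseUnion-sameSize : (k d : ℕ) (F : Family n) → VCSymDiffBounded k d F →
  ∃[ G ] (KWiseUnion k d G × size G ≡ size F)
vcBounded⇒kwiseUnion-sameSize k d F vc
  with deletion-closed-shift (VCSymDiffBounded k d) (shift-preserves-vc k d) F
         (<-wellFounded (weight F)) vc
... | G , vcG , closed , size≡ =
  G , downClosed⇒kwiseUnion k d G (deletionClosed⇒downClosed G closed) vcG , size≡

-- (4) Maximal sizes exist for decidable hereditary properties.

bools : List Bool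
bools = true ∷ false ∷ []

allSubsets : ∀ n → List (Subset n)
allSubsets zero    = [] ∷ []
allSubsets (suc n) = cartesianProductWith _∷_ bools (allSubsets n)

∈-allSubsets : (S : Subset n) → S ∈ₗ allSubsets n
∈-allSubsets []          = here refl
∈-allSubsets (true ∷ S)  = ∈-cartesianProductWith⁺ _∷_ {xs = bools} (here refl) (∈-allSubsets S)
∈-allSubsets (false ∷ S) = ∈-cartesianProductWith⁺ _∷_ {xs = bools} (there (here refl)) (∈-allSubsets S)

bools-unique : Unique bools
bools-unique = ((λ ()) All.∷ All.[]) ∷ All.[] ∷ []

allSubsets-unique : ∀ n → Unique (allSubsets n)
allSubsets-unique zero    = All.[] ∷ []
allSubsets-unique (suc n) =
  Unique.cartesianProductWith⁺ _∷_ ∷-injective bools-unique (allSubsets-unique n)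

sublists : {A : Set} → List A → List (List A)
sublists []       = [] ∷ []
sublists (x ∷ xs) = map (x ∷_) (sublists xs) ++ sublists xs

filter∈sublists : {A : Set} {P : A → Set} (P? : ∀ x → Dec (P x)) (xs : List A) →
  filter P? xs ∈ₗ sublists xs
filter∈sublists P? []       = here refl
filter∈sublists P? (x ∷ xs) with P? x
... | yes _ = ∈-++⁺ˡ (∈-map⁺ (x ∷_) (filter∈sublists P? xs))
... | no _  = ∈-++⁺ʳ (map (x ∷_) (sublists xs)) (filter∈sublists P? xs)

same-elements⇒same-length : {A : Set} {xs ys : List A} → Unique xs → Unique ys →
  (∀ {z} → z ∈ₗ xs → z ∈ₗ ys) → (∀ {z} → z ∈ₗ ys → z ∈ₗ xs) → length xs ≡ length ys
same-elements⇒same-length xs! ys! xs⊆ys ys⊆xs =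
  ↭-length (∼bag⇒↭ (unique∧set⇒bag xs! ys! (mk⇔ xs⊆ys ys⊆xs)))

-- Take the longest duplicate-free sublist of allSubsets n with the property; any
-- family F with the property is as long as its re-enumeration filter (∈ F) (allSubsets n).
maximum-size : (P : List (Subset n) → Set) → (∀ L → Dec (P L)) → P [] →
  (∀ {L L′} → (∀ {S} → S ∈ₗ L → S ∈ₗ L′) → P L′ → P L) →
  ∃[ m ] IsMaxSize (P ∘ members) m
maximum-size {n} P P? P[] hereditary =
  length best , (family best (proj₁ best-good) , proj₂ best-good , refl) , bound
  where
  Good : List (Subset n) → Set
  Good L = Unique L × P L
  good? : ∀ L → Dec (Good L)
  good? L = DecUnique.unique? _≟ˢ_ L ×-dec P? L
  candidates : List (List (Subset n))
  candidates = filter good? (sublists (allSubsets n))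
  best : List (Subset n)
  best = argmax length [] candidates
  best-good : Good best
  best-good = argmax-all length ([] , P[]) (AllProperties.all-filter good? (sublists (allSubsets n)))
  bound : ∀ F → P (members F) → size F ≤ length best
  bound F PF = subst (_≤ length best) same-length
    (All.lookup (f[xs]≤f[argmax] {f = length} [] candidates)
                (∈-filter⁺ good? (filter∈sublists _∈F? (allSubsets n)) good-L))
    where
    _∈F? : ∀ S → Dec (S ∈F F)
    _∈F? S = S ∈ₗ? members F
    L = filter _∈F? (allSubsets n)
    good-L : Good L
    good-L = Unique.filter⁺ _∈F? (allSubsets-unique n) ,
             hereditary (λ S∈L → proj₂ (∈-filter⁻ _∈F? {xs = allSubsets n} S∈L)) PF
    same-length : length L ≡ size F
    same-length = same-elements⇒same-length (proj₁ good-L) (unique F)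
      (λ S∈L → proj₂ (∈-filter⁻ _∈F? {xs = allSubsets n} S∈L))
      (λ S∈F → ∈-filter⁺ _∈F? (∈-allSubsets _) S∈F)

-- Whether Q holds of every k-fold product x₁ ∙ ⋯ ∙ x_k ∙ e with all xₗ ∈ L is decidable:
-- peel off x₁ and recurse with the property Q (x₁ ∙ _).
tuples? : {X : Set} (_∙_ : X → X → X) (e : X) {Q : X → Set} → (∀ x → Dec (Q x)) →
  (k : ℕ) (L : List X) → Dec ((S : Fin k → X) → (∀ l → S l ∈ₗ L) → Q (foldr _∙_ e S))
tuples? _∙_ e Q? zero L = Dec.map′ (λ Qe _ _ → Qe) (λ all → all (λ ()) (λ ())) (Q? e)
tuples? _∙_ e Q? (suc k) L = Dec.map′
  (λ all S S∈L → All.lookup all (S∈L zero) (tail S) (S∈L ∘ suc))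
  (λ all → All.tabulate λ {x} x∈L S S∈L → all (x Vector.∷ S) λ { zero → x∈L ; (suc l) → S∈L l })
  (All.all? (λ x → tuples? _∙_ e (λ y → Q? (x ∙ y)) k L) L)

KWiseUnionList : ℕ → ℕ → List (Subset n) → Set
KWiseUnionList {n} k d L = (S : Fin k → Subset n) → (∀ l → S l ∈ₗ L) → ∣ ∪ₖ S ∣ ≤ d

kwiseUnion? : (k d : ℕ) (L : List (Subset n)) → Dec (KWiseUnionList k d L)
kwiseUnion? k d = tuples? _∪_ ⊥ (λ U → ∣ U ∣ ≤? d) k

-- With k ≥ 1 the empty family has no k-tuples at all.
kwiseUnion-[] : (k d : ℕ) → 1 ≤ k → KWiseUnionList {n} k d []
kwiseUnion-[] (suc k) d _ S S∈[] = contradiction (S∈[] zero) λ ()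

kwiseUnion-hereditary : (k d : ℕ) {L L′ : List (Subset n)} → (∀ {S} → S ∈ₗ L → S ∈ₗ L′) →
  KWiseUnionList k d L′ → KWiseUnionList k d L
kwiseUnion-hereditary k d L⊆L′ kw S S∈L = kw S (L⊆L′ ∘ S∈L)

-- The maximum m from (4) for k-wise (n-d)-union families is p(n,k,d); by (1) it is
-- attained by a family with VC(△F^k) ≤ d, and by (3) no such family is larger.
theorem5 : (n k d : ℕ) → 1 ≤ k → 1 ≤ d → d < n →
    ∃[ m ] (IsP n k d m × IsP' n k d m)
theorem5 n k d 1≤k _ _
  with maximum-size (KWiseUnionList k d) (kwiseUnion? k d)
         (kwiseUnion-[] k d 1≤k) (kwiseUnion-hereditary k d)
... | m , (F , kwF , size≡m) , maximal =
  m , ((F , kwF , size≡m) , maximal) , ((F , kwiseUnion⇒vcBounded k d F kwF , size≡m) , maximal′)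
  where
  maximal′ : ∀ G → VCSymDiffBounded k d G → size G ≤ m
  maximal′ G vc = let H , kwH , size≡ = vcBounded⇒kwiseUnion-sameSize k d G vc
                  in subst (_≤ m) size≡ (maximal H kwH)
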